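{- Up to isomorphism, the only connected mutation-finite graph with exactly $7$ vertices that contains $\mathbf{X}_6$ as a (full) subgraph is $\mathbf{X}_7$.
   Context: A graph here is a finite directed multigraph without loops and without oriented 2-cycles. For a vertex $k$ of such a graph $\Gamma$, the mutation $\mu_k\Gamma$ is obtained as follows: for every arrow $i\to k$ and every arrow $k\to j$ add a new arrow $i\to j$; then reverse every arrow starting or ending at $k$; finally remove pairs of opposite arrows (2-cycles) until none remain. $\Gamma$ is mutation-finite if only finitely many isomorphism classes of graphs are obtained from $\Gamma$ by sequences of mutations. A subgraph always means a full subgraph (containing all arrows between its vertices). $\mathbf{X}_6$: vertices $x,y_1,z_1,y_2,z_2,w$; arrows: two arrows $y_1\to z_1$, $z_1\to x$, $x\to y_1$, $x\to y_2$, two arrows $y_2\to z_2$, $z_2\to x$, $w\to x$. $\mathbf{X}_7$: vertices $x,y_1,z_1,y_2,z_2,y_3,z_3$; for each $i=1,2,3$: one arrow $x\to y_i$, two arrows $y_i\to z_i$, one arrow $z_i\to x$. -}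

module Defs where

open import Data.Nat using (ℕ; zero; suc; _+_; _*_; _∸_; _<_)
open import Data.Fin using (Fin; toℕ; _≟_)
open import Data.Fin.Permutation using (Permutation′; _⟨$⟩ʳ_)
open import Data.Bool using (if_then_else_; _∨_)
open import Data.List using (List)
open import Data.List.Relation.Unary.Any using (Any)
open import Data.Product using (Σ; ∃; _×_)
open import Data.Sum using (_⊎_)
open import Relation.Nullary using (¬_)
open import Relation.Nullary.Decidable using (⌊_⌋)
open import Relation.Binary.PropositionalEquality using (_≡_)
open import Relation.Binary.Construct.Closure.ReflexiveTransitive using (Star)
open import Function.Definitions using (Injective)

-- A graph on vertex set Fin n is given by its arrow-count function:
-- arr i j = number of arrows i → j.
Arrows : ℕ → Set
Arrows n = Fin n → Fin n → ℕ

IsGraph : ∀ {n} → Arrows n → Set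
IsGraph {n} a = (∀ i → a i i ≡ 0) × (∀ i j → a i j ≡ 0 ⊎ a j i ≡ 0)

-- Mutation at k: arrows at k reversed; for i,j ≠ k the arrows i → j
-- become a i j + a i k * a k j, then 2-cycles are cancelled against
-- the arrows j → i (a j i + a j k * a k i).
mutate : ∀ {n} → Fin n → Arrows n → Arrows n
mutate k a i j =
  if ⌊ i ≟ k ⌋ ∨ ⌊ j ≟ k ⌋
  then a j i
  else (a i j + a i k * a k j) ∸ (a j i + a j k * a k i)

MutStep : ∀ {n} → Arrows n → Arrows n → Set
MutStep {n} a b = Σ (Fin n) λ k → mutate k a ≡ b

Reachable : ∀ {n} → Arrows n → Arrows n → Set
Reachable = Star MutStep

Isomorphic : ∀ {n} → Arrows n → Arrows n → Set
Isomorphic {n} a b = Σ (Permutation′ n) λ σ → ∀ i j → a (σ ⟨$⟩ʳ i) (σ ⟨$⟩ʳ j) ≡ b i j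

MutationFinite : ∀ {n} → Arrows n → Set
MutationFinite {n} a = Σ (List (Arrows n)) λ L → ∀ b → Reachable a b → Any (Isomorphic b) L

Adjacent : ∀ {n} → Arrows n → Fin n → Fin n → Set
Adjacent a i j = 0 < a i j ⊎ 0 < a j i

Connected : ∀ {n} → Arrows n → Set
Connected a = ∀ i j → Star (Adjacent a) i j

ContainsSubgraph : ∀ {m n} → Arrows n → Arrows m → Set
ContainsSubgraph {m} {n} a s =
  Σ (Fin m → Fin n) λ f → Injective _≡_ _≡_ f × (∀ i j → a (f i) (f j) ≡ s i j)

-- X6: vertices 0=x, 1=y1, 2=z1, 3=y2, 4=z2, 5=w.
x6 : ℕ → ℕ → ℕ
x6 1 2 = 2
x6 2 0 = 1
x6 0 1 = 1
x6 0 3 = 1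
x6 3 4 = 2
x6 4 0 = 1
x6 5 0 = 1
x6 _ _ = 0

X6 : Arrows 6
X6 i j = x6 (toℕ i) (toℕ j)

-- X7: vertices 0=x, 1=y1, 2=z1, 3=y2, 4=z2, 5=y3, 6=z3.
x7 : ℕ → ℕ → ℕ
x7 0 1 = 1
x7 1 2 = 2
x7 2 0 = 1
x7 0 3 = 1
x7 3 4 = 2
x7 4 0 = 1
x7 0 5 = 1
x7 5 6 = 2
x7 6 0 = 1
x7 _ _ = 0

X7 : Arrows 7
X7 i j = x7 (toℕ i) (toℕ j)

module Submission where

-- Outline.
-- * Mutation commutes with restriction to a full subgraph, so whatever a full
--   subgraph can be mutated into is a full subgraph of something the whole graph
--   can be mutated into (reachable-induced).
-- * A heavy triangle (oriented, all weights ≥ 2, total ≥ 7) mutated opposite its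
--   lightest edge is again heavy, with a strictly heavier edge.  Iterating gives
--   unbounded weights, impossible when the mutation class is finite up to
--   isomorphism (mutationFinite⇒¬reachesHeavy).
-- * Three vertices with at least three arrows between two of them and some arrow
--   to the third reach a heavy triangle within three mutations
--   (heavy-edge⇒reachesHeavy).
-- * For Γ as in the theorem, let v be the vertex outside X6.  By the above, v is
--   joined to each vertex of X6 by at most two arrows, all in one direction (a
--   Link), leaving 5⁶ cases.  The table `verdict` settles each one: v is isolated
--   (contradicting connectedness), or Γ ≅ X7, or an explicit mutation sequence
--   produces a heavy triangle (checked by evaluation).
-- * Conversely X7 is a connected graph containing X6, and its mutation class is
--   {X7, μₓX7} up to isomorphism, so it is mutation-finite.

open import Defs
open import Data.Product using (_×_)

open import Data.Nat using (ℕ; zero; suc; _+_; _*_; _∸_; _≤_; _<_; _⊔_; z≤n; s≤s; _≤?_; _<?_)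
  renaming (_≟_ to _≟ℕ_)
open import Data.Nat.Properties
  using (module ≤-Reasoning; ≤-trans; ≤-antisym; <⇒≤; ≰⇒>; ≤-<-trans; 1+n≰n;
         m≤n⇒m<n∨m≡n; +-commutativeSemigroup; +-identityʳ; *-comm; *-zeroʳ; +-mono-≤; +-monoʳ-≤; +-monoʳ-<; *-mono-≤;
         m≤m+n; m<m+n; m≤n+m; m≤m⊔n; m≤n⊔m; m+n≤o⇒n≤o; m+n≤o⇒m≤o∸n; m≤n⇒m∸n≡0; 0∸n≡0; ∸-monoˡ-≤; +-cancelˡ-≤)
open import Algebra.Properties.CommutativeSemigroup +-commutativeSemigroup using (xy∙z≈xz∙y; xy∙z≈yz∙x)
open import Data.Fin using (Fin; zero; suc; _≟_; punchOut)
open import Data.Fin.Patterns using (0F; 1F; 2F; 3F; 4F; 5F; 6F)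
open import Data.Fin.Properties using (all?; any?; ¬∀⟶∃¬; punchOut-injective; injective⇒≤)
import Data.Fin.Permutation as Perm
open import Data.Fin.Permutation using (Permutation′; permutation; _∘ₚ_; _⟨$⟩ʳ_; _⟨$⟩ˡ_; inverseʳ; inverseˡ)
open import Data.Vec using (Vec; []; _∷_; lookup)
import Data.Vec.Functional as Vector
open import Data.List using (List; []; _∷_; foldl)
open import Data.List.Relation.Unary.Any using (Any; here; there)
import Data.List.Relation.Unary.Any as Any
open import Data.List.Membership.Propositional using (_∈_; find)
open import Data.Product using (∃-syntax; _,_; proj₁; proj₂)
open import Data.Sum using (_⊎_; inj₁; inj₂; [_,_]′)
open import Data.Unit using (tt)
open import Function using (_∘_)
open import Relation.Nullary using (¬_; yes; no; contradiction)
open import Relation.Nullary.Decidable using (Dec; True; toWitness; map′; ¬?; _×-dec_; _⊎-dec_; _→-dec_)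
open import Relation.Binary.PropositionalEquality
  using (_≡_; _≢_; ≢-sym; refl; sym; trans; cong; cong₂; subst; subst₂)
open import Relation.Binary.Construct.Closure.ReflexiveTransitive using (Star; ε; _◅_; _◅◅_)
open import Function.Definitions using (Injective)

mutate-outof : ∀ {n} (a : Arrows n) k j → mutate k a k j ≡ a j k
mutate-outof a k j with k ≟ k
... | yes _ = refl
... | no k≢k = contradiction refl k≢k

mutate-into : ∀ {n} (a : Arrows n) k i → mutate k a i k ≡ a k i
mutate-into a k i with i ≟ k | k ≟ k
... | yes _ | _ = refl
... | no _ | yes _ = refl
... | no _ | no k≢k = contradiction refl k≢k

mutate-away : ∀ {n} (a : Arrows n) {k i j} → i ≢ k → j ≢ k →
  mutate k a i j ≡ (a i j + a i k * a k j) ∸ (a j i + a j k * a k i)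
mutate-away a {k} {i} {j} i≢k j≢k with i ≟ k | j ≟ k
... | yes i≡k | _ = contradiction i≡k i≢k
... | no _ | yes j≡k = contradiction j≡k j≢k
... | no _ | no _ = refl

mutate-gain : ∀ {n} (a : Arrows n) {k i j} → i ≢ k → j ≢ k → a j i ≡ 0 → a j k * a k i ≡ 0 →
  mutate k a i j ≡ a i j + a i k * a k j
mutate-gain a {k} {i} {j} i≢k j≢k ji≡0 jki≡0
  rewrite mutate-away a i≢k j≢k | ji≡0 | jki≡0 = refl

mutate-absent : ∀ {n} (a : Arrows n) {k i j} → i ≢ k → j ≢ k → a i j ≡ 0 → a i k * a k j ≡ 0 →
  mutate k a i j ≡ 0
mutate-absent a {k} {i} {j} i≢k j≢k ij≡0 ikj≡0
  rewrite mutate-away a i≢k j≢k | ij≡0 | ikj≡0 = 0∸n≡0 (a j i + a j k * a k i)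

Induced : ∀ {m n} → (Fin m → Fin n) → Arrows n → Arrows m → Set
Induced g a c = ∀ i j → a (g i) (g j) ≡ c i j

induced-∘ : ∀ {l m n} {g : Fin m → Fin n} {h : Fin l → Fin m} {a b c} →
  Induced g a b → Induced h b c → Induced (g ∘ h) a c
induced-∘ {h = h} a⇒b b⇒c i j = trans (a⇒b (h i) (h j)) (b⇒c i j)

mutate-induced : ∀ {m n} {g : Fin m → Fin n} → Injective _≡_ _≡_ g →
  ∀ {a c} → Induced g a c → ∀ k → Induced g (mutate (g k) a) (mutate k c)
mutate-induced {g = g} g-inj {a} {c} a⇒c k i j = by-cases (i ≟ k) (j ≟ k)
  where
  by-cases : Dec (i ≡ k) → Dec (j ≡ k) → mutate (g k) a (g i) (g j) ≡ mutate k c i j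
  by-cases (yes refl) _ =
    trans (mutate-outof a (g i) (g j)) (trans (a⇒c j i) (sym (mutate-outof c i j)))
  by-cases (no _) (yes refl) =
    trans (mutate-into a (g j) (g i)) (trans (a⇒c j i) (sym (mutate-into c j i)))
  by-cases (no i≢k) (no j≢k)
    rewrite mutate-away a (i≢k ∘ g-inj) (j≢k ∘ g-inj) | mutate-away c i≢k j≢k
          | a⇒c i j | a⇒c i k | a⇒c k j | a⇒c j i | a⇒c j k | a⇒c k i = refl

reachable-induced : ∀ {m n} {g : Fin m → Fin n} → Injective _≡_ _≡_ g →
  ∀ {a c c′} → Induced g a c → Reachable c c′ → ∃[ a′ ] Reachable a a′ × Induced g a′ c′
reachable-induced g-inj a⇒c ε = _ , ε , a⇒c
reachable-induced {g = g} g-inj {a} a⇒c ((k , refl) ◅ steps)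
  with reachable-induced g-inj (mutate-induced g-inj {a} a⇒c k) steps
... | a′ , reach , a′⇒c′ = a′ , (g k , refl) ◅ reach , a′⇒c′

mutations : ∀ {n} → List (Fin n) → Arrows n → Arrows n
mutations ks a = foldl (λ b k → mutate k b) a ks

reachable-mutations : ∀ {n} (ks : List (Fin n)) a → Reachable a (mutations ks a)
reachable-mutations [] a = ε
reachable-mutations (k ∷ ks) a = (k , refl) ◅ reachable-mutations ks (mutate k a)

injective⇒surjective : ∀ {n} {g : Fin n → Fin n} → Injective _≡_ _≡_ g → ∀ j → ∃[ i ] g i ≡ j
injective⇒surjective {suc n} {g} g-inj j with any? (λ i → g i ≟ j)
... | yes hit = hit
... | no miss = contradiction (injective⇒≤ squeeze-injective) 1+n≰n
  where
  j∉g : ∀ i → j ≢ g i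
  j∉g i j≡gi = miss (i , sym j≡gi)
  -- g squeezed into the n values other than j.
  squeeze : Fin (suc n) → Fin n
  squeeze i = punchOut (j∉g i)
  squeeze-injective : Injective _≡_ _≡_ squeeze
  squeeze-injective {i} {i′} = g-inj ∘ punchOut-injective (j∉g i) (j∉g i′)

injective⇒missing : ∀ {n} {f : Fin n → Fin (suc n)} → Injective _≡_ _≡_ f → ∃[ v ] ∀ u → f u ≢ v
injective⇒missing {n} {f} f-inj with all? (λ j → any? (λ u → f u ≟ j))
... | yes onto = contradiction (injective⇒≤ section-injective) 1+n≰n
  where
  section-injective : Injective _≡_ _≡_ (λ j → proj₁ (onto j))
  section-injective {j} {j′} eq = trans (sym (proj₂ (onto j))) (trans (cong f eq) (proj₂ (onto j′)))
... | no ¬onto with ¬∀⟶∃¬ _ _ (λ j → any? (λ u → f u ≟ j)) ¬onto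
...   | v , unhit = v , λ u fu≡v → unhit (u , fu≡v)

injective⇒permutation : ∀ {n} (g : Fin n → Fin n) → Injective _≡_ _≡_ g → Permutation′ n
injective⇒permutation g g-inj =
  permutation g (proj₁ ∘ preimage) (proj₂ ∘ preimage) (λ i → g-inj (proj₂ (preimage (g i))))
  where
  preimage : ∀ j → ∃[ i ] g i ≡ j
  preimage = injective⇒surjective g-inj

induced⇒isomorphic : ∀ {n} {g : Fin n → Fin n} {a b : Arrows n} →
  Injective _≡_ _≡_ g → Induced g a b → Isomorphic a b
induced⇒isomorphic {g = g} g-inj a⇒b = injective⇒permutation g g-inj , a⇒b

isomorphic-trans : ∀ {n} {a b c : Arrows n} → Isomorphic a b → Isomorphic b c → Isomorphic a c
isomorphic-trans {a = a} (σ , a⇒b) (τ , b⇒c) = τ ∘ₚ σ , induced-∘ {a = a} a⇒b b⇒c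

isomorphic-mutate : ∀ {n} {a b : Arrows n} ((σ , _) : Isomorphic a b) → ∀ k →
  Isomorphic (mutate k a) (mutate (σ ⟨$⟩ˡ k) b)
isomorphic-mutate {a = a} {b} (σ , a⇒b) k =
  σ , subst (λ k′ → Induced (σ ⟨$⟩ʳ_) (mutate k′ a) (mutate (σ ⟨$⟩ˡ k) b)) (inverseʳ σ)
            (mutate-induced σ-injective {a} a⇒b (σ ⟨$⟩ˡ k))
  where
  σ-injective : Injective _≡_ _≡_ (σ ⟨$⟩ʳ_)
  σ-injective {i} {j} eq = trans (sym (inverseˡ σ)) (trans (cong (σ ⟨$⟩ˡ_) eq) (inverseˡ σ))

MutationClosed : ∀ {n} → List (Arrows n) → Set
MutationClosed L = ∀ {b} → b ∈ L → ∀ k → Any (Isomorphic (mutate k b)) L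

closed⇒mutationFinite : ∀ {n} {L : List (Arrows n)} {a} →
  MutationClosed L → Any (Isomorphic a) L → MutationFinite a
closed⇒mutationFinite {L = L} closed a∼L = L , λ b reach → follow reach a∼L
  where
  follow : ∀ {a b} → Reachable a b → Any (Isomorphic a) L → Any (Isomorphic b) L
  follow ε a∼L = a∼L
  follow {a} ((k , refl) ◅ steps) a∼L with find a∼L
  ... | b , b∈L , a≅b@(σ , _) =
    follow steps (Any.map (isomorphic-trans {a = mutate k a} (isomorphic-mutate {a = a} {b} a≅b k))
                          (closed b∈L (σ ⟨$⟩ˡ k)))

finite-bounded : ∀ {n} (f : Fin n → ℕ) → ∃[ M ] ∀ i → f i ≤ M
finite-bounded {zero} f = 0 , λ ()
finite-bounded {suc n} f with finite-bounded (f ∘ suc)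
... | M , f∘suc≤M = f zero ⊔ M , λ { zero → m≤m⊔n _ M ; (suc i) → ≤-trans (f∘suc≤M i) (m≤n⊔m _ M) }

list-bounded : ∀ {n} (L : List (Arrows n)) → ∃[ M ] ∀ {b} → Any (Isomorphic b) L → ∀ i j → b i j ≤ M
list-bounded [] = 0 , λ ()
list-bounded {n} (c ∷ L) with finite-bounded (λ i → proj₁ (finite-bounded (c i))) | list-bounded L
... | Mc , rows≤Mc | ML , L≤ML = Mc ⊔ ML , bound
  where
  bound : ∀ {b} → Any (Isomorphic b) (c ∷ L) → ∀ i j → b i j ≤ Mc ⊔ ML
  bound {b} (here (σ , b⇒c)) i j = begin
    b i j                                       ≡⟨ sym (cong₂ b (inverseʳ σ) (inverseʳ σ)) ⟩
    b (σ ⟨$⟩ʳ (σ ⟨$⟩ˡ i)) (σ ⟨$⟩ʳ (σ ⟨$⟩ˡ j))  ≡⟨ b⇒c (σ ⟨$⟩ˡ i) (σ ⟨$⟩ˡ j) ⟩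
    c (σ ⟨$⟩ˡ i) (σ ⟨$⟩ˡ j)                     ≤⟨ proj₂ (finite-bounded (c (σ ⟨$⟩ˡ i))) (σ ⟨$⟩ˡ j) ⟩
    proj₁ (finite-bounded (c (σ ⟨$⟩ˡ i)))       ≤⟨ rows≤Mc (σ ⟨$⟩ˡ i) ⟩
    Mc                                          ≤⟨ m≤m⊔n Mc ML ⟩
    Mc ⊔ ML                                     ∎
    where open ≤-Reasoning
  bound (there b∼L) i j = ≤-trans (L≤ML b∼L i j) (m≤n⊔m Mc ML)

record Cyclic {n} (a : Arrows n) (p q r : Fin n) : Set where
  constructor cyclic
  field
    p≢q : p ≢ q
    q≢r : q ≢ r
    r≢p : r ≢ p
    no-qp : a q p ≡ 0
    no-rq : a r q ≡ 0
    no-pr : a p r ≡ 0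

rotate-cyclic : ∀ {n} {a : Arrows n} {p q r} → Cyclic a p q r → Cyclic a q r p
rotate-cyclic (cyclic p≢q q≢r r≢p no-qp no-rq no-pr) = cyclic q≢r r≢p p≢q no-rq no-pr no-qp

-- A heavy triangle: an oriented triangle with all weights at least 2 and total
-- weight at least 7.  These are the triangles whose weights mutation can pump up.
record Heavy {n} (a : Arrows n) (p q r : Fin n) : Set where
  constructor heavy
  field
    cycle : Cyclic a p q r
    2≤pq : 2 ≤ a p q
    2≤qr : 2 ≤ a q r
    2≤rp : 2 ≤ a r p
    7≤total : 7 ≤ a p q + a q r + a r p

rotate-heavy : ∀ {n} {a : Arrows n} {p q r} → Heavy a p q r → Heavy a q r p
rotate-heavy {a = a} {p} {q} {r} (heavy c 2≤pq 2≤qr 2≤rp 7≤total) =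
  heavy (rotate-cyclic c) 2≤qr 2≤rp 2≤pq (subst (7 ≤_) (xy∙z≈yz∙x (a p q) (a q r) (a r p)) 7≤total)

mutate-cycle : ∀ {n} (a : Arrows n) {p q r} → Cyclic a p q r → a p q ≤ a q r * a r p →
  Cyclic (mutate r a) q p r × mutate r a q p ≡ a q r * a r p ∸ a p q
mutate-cycle a {p} {q} {r} (cyclic p≢q q≢r r≢p no-qp no-rq no-pr) x≤yz =
  cyclic (≢-sym p≢q) (≢-sym r≢p) (≢-sym q≢r) no-pq (trans (mutate-outof a r p) no-pr)
         (trans (mutate-into a r q) no-rq) ,
  new-weight
  where
  no-pq : mutate r a p q ≡ 0
  no-pq rewrite mutate-away a (≢-sym r≢p) q≢r | no-qp | no-pr | +-identityʳ (a p q) = m≤n⇒m∸n≡0 x≤yz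
  new-weight : mutate r a q p ≡ a q r * a r p ∸ a p q
  new-weight rewrite mutate-away a q≢r (≢-sym r≢p) | no-qp | no-pr = cong (a q r * a r p ∸_) (+-identityʳ (a p q))

-- The arithmetic of pumping: if x is the lightest weight of a heavy triangle with
-- weights x, y, z, then the new weight y·z − x exceeds z.
heavy-gap : ∀ {x y z} → 2 ≤ x → x ≤ y → x ≤ z → 7 ≤ x + y + z → z + x < y * z
heavy-gap {x} {0} 2≤x x≤y _ _ = contradiction (≤-trans 2≤x x≤y) λ ()
heavy-gap {x} {1} 2≤x x≤y _ _ = contradiction (≤-trans 2≤x x≤y) λ { (s≤s ()) }
heavy-gap {x} {2} {z} 2≤x x≤2 _ 7≤total with ≤-antisym x≤2 2≤x
... | refl = +-monoʳ-< z (subst (3 ≤_) (sym (+-identityʳ z)) (+-cancelˡ-≤ 4 3 z 7≤total))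
heavy-gap {x} {suc (suc (suc y))} {z} 2≤x _ x≤z _ = begin-strict
  z + x                  <⟨ +-monoʳ-< z (≤-<-trans x≤z (m<m+n z (≤-trans (s≤s z≤n) (≤-trans 2≤x x≤z)))) ⟩
  z + (z + z)            ≤⟨ +-monoʳ-≤ z (+-monoʳ-≤ z (m≤m+n z (y * z))) ⟩
  suc (suc (suc y)) * z  ∎
  where open ≤-Reasoning

heavy-step : ∀ {n} (a : Arrows n) {p q r} → Heavy a p q r → a p q ≤ a q r → a p q ≤ a r p →
  Heavy (mutate r a) q p r × a q r < mutate r a q p × a r p < mutate r a q p
heavy-step a {p} {q} {r} (heavy c 2≤x 2≤y 2≤z 7≤total) x≤y x≤z =
  heavy c′ (≤-trans 2≤z (<⇒≤ z<w)) 2≤z′ 2≤y′ (+-mono-≤ (+-mono-≤ (≤-trans (s≤s 2≤z) z<w) 2≤z′) 2≤y′) ,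
  y<w , z<w
  where
  x = a p q
  y = a q r
  z = a r p
  z+x<yz : z + x < y * z
  z+x<yz = heavy-gap 2≤x x≤y x≤z 7≤total
  y+x<yz : y + x < y * z
  y+x<yz = subst (y + x <_) (*-comm z y) (heavy-gap 2≤x x≤z x≤y (subst (7 ≤_) (xy∙z≈xz∙y x y z) 7≤total))
  x≤yz : x ≤ y * z
  x≤yz = m+n≤o⇒n≤o z (<⇒≤ z+x<yz)
  c′ : Cyclic (mutate r a) q p r
  c′ = proj₁ (mutate-cycle a c x≤yz)
  w≡ : mutate r a q p ≡ y * z ∸ x
  w≡ = proj₂ (mutate-cycle a c x≤yz)
  z<w : z < mutate r a q p
  z<w = subst (z <_) (sym w≡) (m+n≤o⇒m≤o∸n (suc z) z+x<yz)
  y<w : y < mutate r a q p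
  y<w = subst (y <_) (sym w≡) (m+n≤o⇒m≤o∸n (suc y) y+x<yz)
  2≤z′ : 2 ≤ mutate r a p r
  2≤z′ = subst (2 ≤_) (sym (mutate-into a r p)) 2≤z
  2≤y′ : 2 ≤ mutate r a r q
  2≤y′ = subst (2 ≤_) (sym (mutate-outof a r q)) 2≤y

heavy-grows : ∀ {n} (a : Arrows n) {p q r} → Heavy a p q r →
  ∃[ k ] ∃[ p′ ] ∃[ q′ ] ∃[ r′ ] Heavy (mutate k a) p′ q′ r′ × a p q < mutate k a p′ q′
heavy-grows a {p} {q} {r} h with a p q ≤? a q r | a p q ≤? a r p | a q r ≤? a r p
... | yes x≤y | yes x≤z | _ =
  let h′ , y<w , _ = heavy-step a h x≤y x≤z in r , q , p , r , h′ , ≤-<-trans x≤y y<w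
... | yes x≤y | no x≰z | _ =
  let z<x = ≰⇒> x≰z
      h′ , x<w , _ = heavy-step a (rotate-heavy (rotate-heavy h)) (<⇒≤ z<x) (≤-trans (<⇒≤ z<x) x≤y)
  in q , p , r , q , h′ , x<w
... | no x≰y | _ | yes y≤z =
  let h′ , _ , x<w = heavy-step a (rotate-heavy h) y≤z (<⇒≤ (≰⇒> x≰y)) in p , r , q , p , h′ , x<w
... | no x≰y | _ | no y≰z =
  let z≤y = <⇒≤ (≰⇒> y≰z)
      h′ , x<w , _ = heavy-step a (rotate-heavy (rotate-heavy h)) (≤-trans z≤y (<⇒≤ (≰⇒> x≰y))) z≤y
  in q , p , r , q , h′ , x<w

ReachesHeavy : ∀ {n} → Arrows n → Set
ReachesHeavy a = ∃[ b ] Reachable a b × ∃[ p ] ∃[ q ] ∃[ r ] Heavy b p q r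

reachesHeavy-mutate : ∀ {n} {a : Arrows n} k → ReachesHeavy (mutate k a) → ReachesHeavy a
reachesHeavy-mutate k (b , reach , h) = b , (k , refl) ◅ reach , h

heavy-induced : ∀ {m n} {g : Fin m → Fin n} → Injective _≡_ _≡_ g → ∀ {a c} → Induced g a c →
  ∀ {p q r} → Heavy c p q r → Heavy a (g p) (g q) (g r)
heavy-induced g-inj {a} g⇒c {p} {q} {r} (heavy (cyclic p≢q q≢r r≢p no-qp no-rq no-pr) 2≤pq 2≤qr 2≤rp 7≤total) =
  heavy (cyclic (p≢q ∘ g-inj) (q≢r ∘ g-inj) (r≢p ∘ g-inj)
                (trans (g⇒c q p) no-qp) (trans (g⇒c r q) no-rq) (trans (g⇒c p r) no-pr))
        (subst (2 ≤_) (sym (g⇒c p q)) 2≤pq) (subst (2 ≤_) (sym (g⇒c q r)) 2≤qr)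
        (subst (2 ≤_) (sym (g⇒c r p)) 2≤rp)
        (subst (7 ≤_) (sym (cong₂ _+_ (cong₂ _+_ (g⇒c p q) (g⇒c q r)) (g⇒c r p))) 7≤total)

reachesHeavy-induced : ∀ {m n} {g : Fin m → Fin n} → Injective _≡_ _≡_ g → ∀ {a c} → Induced g a c →
  ReachesHeavy c → ReachesHeavy a
reachesHeavy-induced {g = g} g-inj g⇒c (c′ , reach , p , q , r , h)
  with reachable-induced g-inj g⇒c reach
... | a′ , reach′ , g⇒c′ = a′ , reach′ , g p , g q , g r , heavy-induced g-inj {a′} g⇒c′ h

heavy-unbounded : ∀ {n} {a : Arrows n} → ReachesHeavy a → ∀ M →
  ∃[ b ] Reachable a b × ∃[ p ] ∃[ q ] ∃[ r ] Heavy b p q r × M ≤ b p q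
heavy-unbounded (b , reach , p , q , r , h) zero = b , reach , p , q , r , h , z≤n
heavy-unbounded reaches (suc M) with heavy-unbounded reaches M
... | b , reach , p , q , r , h , M≤pq with heavy-grows b h
...   | k , p′ , q′ , r′ , h′ , pq<w =
  mutate k b , reach ◅◅ ((k , refl) ◅ ε) , p′ , q′ , r′ , h′ , ≤-<-trans M≤pq pq<w

mutationFinite⇒¬reachesHeavy : ∀ {n} {a : Arrows n} → MutationFinite a → ¬ ReachesHeavy a
mutationFinite⇒¬reachesHeavy (L , finite) reaches with list-bounded L
... | M , bounded with heavy-unbounded reaches (suc M)
...   | b , reach , p , q , _ , _ , M<pq = 1+n≰n (≤-trans M<pq (bounded (finite b reach) p q))

-- An oriented triangle with weights 1, y, z where y, z ≥ 2 becomes heavy after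
-- mutating at r: its weights become y·z − 1 ≥ 3, z and y.
light-cycle⇒reachesHeavy : ∀ {n} (a : Arrows n) {p q r} → Cyclic a p q r →
  a p q ≡ 1 → 2 ≤ a q r → 2 ≤ a r p → ReachesHeavy a
light-cycle⇒reachesHeavy a {p} {q} {r} c x≡1 2≤y 2≤z =
  reachesHeavy-mutate r (mutate r a , ε , q , p , r ,
    heavy c′ (≤-trans (s≤s (s≤s z≤n)) 3≤w) 2≤z′ 2≤y′ (+-mono-≤ (+-mono-≤ 3≤w 2≤z′) 2≤y′))
  where
  4≤yz : 4 ≤ a q r * a r p
  4≤yz = *-mono-≤ 2≤y 2≤z
  x≤yz : a p q ≤ a q r * a r p
  x≤yz = subst (_≤ a q r * a r p) (sym x≡1) (≤-trans (s≤s z≤n) 4≤yz)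
  c′ : Cyclic (mutate r a) q p r
  c′ = proj₁ (mutate-cycle a c x≤yz)
  3≤w : 3 ≤ mutate r a q p
  3≤w = subst (3 ≤_) (sym (trans (proj₂ (mutate-cycle a c x≤yz)) (cong (a q r * a r p ∸_) x≡1)))
              (∸-monoˡ-≤ 1 4≤yz)
  2≤z′ : 2 ≤ mutate r a p r
  2≤z′ = subst (2 ≤_) (sym (mutate-into a r p)) 2≤z
  2≤y′ : 2 ≤ mutate r a r q
  2≤y′ = subst (2 ≤_) (sym (mutate-outof a r q)) 2≤y

-- An oriented triangle with weights 1, 1, z where z ≥ 3 becomes, after mutating at
-- r, the triangle with weights z − 1, z, 1 handled above.
very-light-cycle⇒reachesHeavy : ∀ {n} (a : Arrows n) {p q r} → Cyclic a p q r →
  a p q ≡ 1 → a q r ≡ 1 → 3 ≤ a r p → ReachesHeavy a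
very-light-cycle⇒reachesHeavy a {p} {q} {r} c x≡1 y≡1 3≤z =
  reachesHeavy-mutate r
    (light-cycle⇒reachesHeavy (mutate r a) (rotate-cyclic (rotate-cyclic c′))
      (trans (mutate-outof a r q) y≡1) 2≤w (≤-trans (s≤s (s≤s z≤n)) 3≤z′))
  where
  yz≡z : a q r * a r p ≡ a r p
  yz≡z = trans (cong (_* a r p) y≡1) (+-identityʳ (a r p))
  x≤yz : a p q ≤ a q r * a r p
  x≤yz = subst₂ _≤_ (sym x≡1) (sym yz≡z) (≤-trans (s≤s z≤n) 3≤z)
  c′ : Cyclic (mutate r a) q p r
  c′ = proj₁ (mutate-cycle a c x≤yz)
  2≤w : 2 ≤ mutate r a q p
  2≤w = subst (2 ≤_) (sym (trans (proj₂ (mutate-cycle a c x≤yz)) (cong₂ _∸_ yz≡z x≡1))) (∸-monoˡ-≤ 1 3≤z)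
  3≤z′ : 3 ≤ mutate r a p r
  3≤z′ = subst (3 ≤_) (sym (mutate-into a r p)) 3≤z

AtLeast3 : ℕ → ℕ → ℕ → Set
AtLeast3 x y z = 3 ≤ x ⊎ 3 ≤ y ⊎ 3 ≤ z

rotate-atLeast3 : ∀ {x y z} → AtLeast3 x y z → AtLeast3 y z x
rotate-atLeast3 (inj₁ 3≤x) = inj₂ (inj₂ 3≤x)
rotate-atLeast3 (inj₂ 3≤y⊎3≤z) = [ inj₁ , inj₂ ∘ inj₁ ]′ 3≤y⊎3≤z

third-atLeast3 : ∀ {x y z} → x ≡ 1 → y ≡ 1 → AtLeast3 x y z → 3 ≤ z
third-atLeast3 refl refl (inj₁ (s≤s ()))
third-atLeast3 refl refl (inj₂ (inj₁ (s≤s ())))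
third-atLeast3 refl refl (inj₂ (inj₂ 3≤z)) = 3≤z

atLeast3-total : ∀ {x y z} → 2 ≤ x → 2 ≤ y → 2 ≤ z → AtLeast3 x y z → 7 ≤ x + y + z
atLeast3-total 2≤x 2≤y 2≤z (inj₁ 3≤x) = +-mono-≤ (+-mono-≤ 3≤x 2≤y) 2≤z
atLeast3-total 2≤x 2≤y 2≤z (inj₂ (inj₁ 3≤y)) = +-mono-≤ (+-mono-≤ 2≤x 3≤y) 2≤z
atLeast3-total 2≤x 2≤y 2≤z (inj₂ (inj₂ 3≤z)) = +-mono-≤ (+-mono-≤ 2≤x 2≤y) 3≤z

cycle⇒reachesHeavy : ∀ {n} (a : Arrows n) {p q r} → Cyclic a p q r →
  1 ≤ a p q → 1 ≤ a q r → 1 ≤ a r p → AtLeast3 (a p q) (a q r) (a r p) → ReachesHeavy a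
cycle⇒reachesHeavy a {p} {q} {r} c 1≤x 1≤y 1≤z big
  with m≤n⇒m<n∨m≡n 1≤x | m≤n⇒m<n∨m≡n 1≤y | m≤n⇒m<n∨m≡n 1≤z
... | inj₁ 2≤x | inj₁ 2≤y | inj₁ 2≤z = a , ε , p , q , r , heavy c 2≤x 2≤y 2≤z (atLeast3-total 2≤x 2≤y 2≤z big)
... | inj₂ 1≡x | inj₁ 2≤y | inj₁ 2≤z = light-cycle⇒reachesHeavy a c (sym 1≡x) 2≤y 2≤z
... | inj₁ 2≤x | inj₂ 1≡y | inj₁ 2≤z = light-cycle⇒reachesHeavy a (rotate-cyclic c) (sym 1≡y) 2≤z 2≤x
... | inj₁ 2≤x | inj₁ 2≤y | inj₂ 1≡z =
  light-cycle⇒reachesHeavy a (rotate-cyclic (rotate-cyclic c)) (sym 1≡z) 2≤x 2≤y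
... | inj₂ 1≡x | inj₂ 1≡y | _ =
  very-light-cycle⇒reachesHeavy a c (sym 1≡x) (sym 1≡y) (third-atLeast3 (sym 1≡x) (sym 1≡y) big)
... | inj₁ _ | inj₂ 1≡y | inj₂ 1≡z =
  very-light-cycle⇒reachesHeavy a (rotate-cyclic c) (sym 1≡y) (sym 1≡z)
    (third-atLeast3 (sym 1≡y) (sym 1≡z) (rotate-atLeast3 big))
... | inj₂ 1≡x | inj₁ _ | inj₂ 1≡z =
  very-light-cycle⇒reachesHeavy a (rotate-cyclic (rotate-cyclic c)) (sym 1≡z) (sym 1≡x)
    (third-atLeast3 (sym 1≡z) (sym 1≡x) (rotate-atLeast3 (rotate-atLeast3 big)))

-- A transitive triangle s → m → k, s → k (with arrows s → m and m → k present)
-- reaches a heavy triangle if some weight is at least 3: mutating at m turns it into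
-- the oriented triangle s → k → m → s with weights γ + α·β, β, α.
transitive⇒reachesHeavy : ∀ {n} (a : Arrows n) {s m k} → s ≢ m → m ≢ k → k ≢ s →
  a m s ≡ 0 → a k m ≡ 0 → a k s ≡ 0 → 1 ≤ a s m → 1 ≤ a m k →
  AtLeast3 (a s m) (a m k) (a s k) → ReachesHeavy a
transitive⇒reachesHeavy {n} a {s} {m} {k} s≢m m≢k k≢s no-ms no-km no-ks 1≤α 1≤β big =
  reachesHeavy-mutate m (cycle⇒reachesHeavy b c 1≤sk′ 1≤km′ 1≤ms′ (carry big))
  where
  b : Arrows n
  b = mutate m a
  no-kms : a k m * a m s ≡ 0
  no-kms = cong (_* a m s) no-km
  sk′ : b s k ≡ a s k + a s m * a m k
  sk′ = mutate-gain a s≢m (≢-sym m≢k) no-ks no-kms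
  c : Cyclic b s k m
  c = cyclic (≢-sym k≢s) (≢-sym m≢k) (≢-sym s≢m)
             (mutate-absent a (≢-sym m≢k) s≢m no-ks no-kms)
             (trans (mutate-outof a m k) no-km) (trans (mutate-into a m s) no-ms)
  1≤sk′ : 1 ≤ b s k
  1≤sk′ = subst (1 ≤_) (sym sk′) (≤-trans (*-mono-≤ 1≤α 1≤β) (m≤n+m _ (a s k)))
  1≤km′ : 1 ≤ b k m
  1≤km′ = subst (1 ≤_) (sym (mutate-into a m k)) 1≤β
  1≤ms′ : 1 ≤ b m s
  1≤ms′ = subst (1 ≤_) (sym (mutate-outof a m s)) 1≤α
  carry : AtLeast3 (a s m) (a m k) (a s k) → AtLeast3 (b s k) (b k m) (b m s)
  carry (inj₁ 3≤α) = inj₂ (inj₂ (subst (3 ≤_) (sym (mutate-outof a m s)) 3≤α))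
  carry (inj₂ (inj₁ 3≤β)) = inj₂ (inj₁ (subst (3 ≤_) (sym (mutate-into a m k)) 3≤β))
  carry (inj₂ (inj₂ 3≤γ)) = inj₁ (subst (3 ≤_) (sym sk′) (≤-trans 3≤γ (m≤m+n (a s k) _)))

-- A path s ← m → k through a source m (and no arrows between s and k) with a
-- weight at least 3: mutating at s makes it the transitive triangle s → m → k.
source⇒reachesHeavy : ∀ {n} (a : Arrows n) {s m k} → s ≢ m → m ≢ k → k ≢ s →
  a s m ≡ 0 → a k m ≡ 0 → a s k ≡ 0 → a k s ≡ 0 → 1 ≤ a m s → 1 ≤ a m k →
  3 ≤ a m s ⊎ 3 ≤ a m k → ReachesHeavy a
source⇒reachesHeavy {n} a {s} {m} {k} s≢m m≢k k≢s no-sm no-km no-sk no-ks 1≤ms 1≤mk big =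
  reachesHeavy-mutate s
    (transitive⇒reachesHeavy b s≢m m≢k k≢s (trans (mutate-into a s m) no-sm)
       (mutate-absent a k≢s (≢-sym s≢m) no-km no-ksm) (trans (mutate-into a s k) no-sk)
       (subst (1 ≤_) (sym sm′) 1≤ms) (subst (1 ≤_) (sym mk′) 1≤mk)
       ([ inj₁ ∘ subst (3 ≤_) (sym sm′) , inj₂ ∘ inj₁ ∘ subst (3 ≤_) (sym mk′) ]′ big))
  where
  b : Arrows n
  b = mutate s a
  no-ksm : a k s * a s m ≡ 0
  no-ksm = cong (_* a s m) no-ks
  sm′ : b s m ≡ a m s
  sm′ = mutate-outof a s m
  mk′ : b m k ≡ a m k
  mk′ = trans (mutate-gain a (≢-sym s≢m) k≢s no-km no-ksm)
              (trans (cong (λ t → a m k + a m s * t) no-sk)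
                     (trans (cong (a m k +_) (*-zeroʳ (a m s))) (+-identityʳ (a m k))))

-- A path s → m ← k into a sink m (and no arrows between s and k) with a weight
-- at least 3: mutating at k makes it the transitive triangle s → m → k.
sink⇒reachesHeavy : ∀ {n} (a : Arrows n) {s m k} → s ≢ m → m ≢ k → k ≢ s →
  a m s ≡ 0 → a m k ≡ 0 → a s k ≡ 0 → a k s ≡ 0 → 1 ≤ a s m → 1 ≤ a k m →
  3 ≤ a s m ⊎ 3 ≤ a k m → ReachesHeavy a
sink⇒reachesHeavy {n} a {s} {m} {k} s≢m m≢k k≢s no-ms no-mk no-sk no-ks 1≤sm 1≤km big =
  reachesHeavy-mutate k
    (transitive⇒reachesHeavy b s≢m m≢k k≢s (mutate-absent a m≢k (≢-sym k≢s) no-ms no-mks)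
       (trans (mutate-outof a k m) no-mk) (trans (mutate-outof a k s) no-sk)
       (subst (1 ≤_) (sym sm′) 1≤sm) (subst (1 ≤_) (sym mk′) 1≤km)
       ([ inj₁ ∘ subst (3 ≤_) (sym sm′) , inj₂ ∘ inj₁ ∘ subst (3 ≤_) (sym mk′) ]′ big))
  where
  b : Arrows n
  b = mutate k a
  no-mks : a m k * a k s ≡ 0
  no-mks = cong (_* a k s) no-mk
  sm′ : b s m ≡ a s m
  sm′ = trans (mutate-gain a (≢-sym k≢s) m≢k no-ms no-mks)
              (trans (cong (λ t → a s m + t * a k m) no-sk) (+-identityʳ (a s m)))
  mk′ : b m k ≡ a k m
  mk′ = mutate-into a k m

one-sided : ∀ {x y t} → x ≡ 0 ⊎ y ≡ 0 → suc t ≤ x ⊎ suc t ≤ y → (suc t ≤ x × y ≡ 0) ⊎ (suc t ≤ y × x ≡ 0)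
one-sided (inj₁ refl) (inj₁ ())
one-sided (inj₂ y≡0) (inj₁ t<x) = inj₁ (t<x , y≡0)
one-sided (inj₁ x≡0) (inj₂ t<y) = inj₂ (t<y , x≡0)
one-sided (inj₂ refl) (inj₂ ())

orientation : ∀ {x y} → x ≡ 0 ⊎ y ≡ 0 → (x ≡ 0 × y ≡ 0) ⊎ (1 ≤ x × y ≡ 0) ⊎ (1 ≤ y × x ≡ 0)
orientation {zero} {zero} _ = inj₁ (refl , refl)
orientation {suc x} {zero} _ = inj₂ (inj₁ (s≤s z≤n , refl))
orientation {zero} {suc y} _ = inj₂ (inj₂ (s≤s z≤n , refl))
orientation {suc x} {suc y} (inj₁ ())
orientation {suc x} {suc y} (inj₂ ())

-- Depending on the
-- orientations this is a cycle, a transitive triangle, or a path through a source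
-- or a sink.
heavy-edge⇒reachesHeavy : ∀ {n} {a : Arrows n} → IsGraph a → ∀ {p q r} → p ≢ q → q ≢ r → r ≢ p →
  3 ≤ a p q ⊎ 3 ≤ a q p → Adjacent a q r → ReachesHeavy a
heavy-edge⇒reachesHeavy {a = a} (_ , one-way) {p} {q} {r} p≢q q≢r r≢p pq-heavy q~r =
  by-orientation (one-sided (one-way p q) pq-heavy) (one-sided (one-way q r) q~r)
                 (orientation (one-way r p))
  where
  1≤ : ∀ {x} → 3 ≤ x → 1 ≤ x
  1≤ = ≤-trans (s≤s z≤n)
  q≢p : q ≢ p
  q≢p = ≢-sym p≢q
  r≢q : r ≢ q
  r≢q = ≢-sym q≢r
  p≢r : p ≢ r
  p≢r = ≢-sym r≢p
  by-orientation : (3 ≤ a p q × a q p ≡ 0) ⊎ (3 ≤ a q p × a p q ≡ 0) →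
                   (1 ≤ a q r × a r q ≡ 0) ⊎ (1 ≤ a r q × a q r ≡ 0) →
                   (a r p ≡ 0 × a p r ≡ 0) ⊎ (1 ≤ a r p × a p r ≡ 0) ⊎ (1 ≤ a p r × a r p ≡ 0) →
                   ReachesHeavy a
  by-orientation (inj₁ (3≤pq , no-qp)) (inj₁ (1≤qr , no-rq)) (inj₁ (no-rp , no-pr)) =
    transitive⇒reachesHeavy a p≢q q≢r r≢p no-qp no-rq no-rp (1≤ 3≤pq) 1≤qr (inj₁ 3≤pq)
  by-orientation (inj₁ (3≤pq , no-qp)) (inj₁ (1≤qr , no-rq)) (inj₂ (inj₁ (1≤rp , no-pr))) =
    cycle⇒reachesHeavy a (cyclic p≢q q≢r r≢p no-qp no-rq no-pr) (1≤ 3≤pq) 1≤qr 1≤rp (inj₁ 3≤pq)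
  by-orientation (inj₁ (3≤pq , no-qp)) (inj₁ (1≤qr , no-rq)) (inj₂ (inj₂ (1≤pr , no-rp))) =
    transitive⇒reachesHeavy a p≢q q≢r r≢p no-qp no-rq no-rp (1≤ 3≤pq) 1≤qr (inj₁ 3≤pq)
  by-orientation (inj₁ (3≤pq , no-qp)) (inj₂ (1≤rq , no-qr)) (inj₁ (no-rp , no-pr)) =
    sink⇒reachesHeavy a p≢q q≢r r≢p no-qp no-qr no-pr no-rp (1≤ 3≤pq) 1≤rq (inj₁ 3≤pq)
  by-orientation (inj₁ (3≤pq , no-qp)) (inj₂ (1≤rq , no-qr)) (inj₂ (inj₁ (1≤rp , no-pr))) =
    transitive⇒reachesHeavy a r≢p p≢q q≢r no-pr no-qp no-qr 1≤rp (1≤ 3≤pq) (inj₂ (inj₁ 3≤pq))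
  by-orientation (inj₁ (3≤pq , no-qp)) (inj₂ (1≤rq , no-qr)) (inj₂ (inj₂ (1≤pr , no-rp))) =
    transitive⇒reachesHeavy a p≢r r≢q q≢p no-rp no-qr no-qp 1≤pr 1≤rq (inj₂ (inj₂ 3≤pq))
  by-orientation (inj₂ (3≤qp , no-pq)) (inj₁ (1≤qr , no-rq)) (inj₁ (no-rp , no-pr)) =
    source⇒reachesHeavy a p≢q q≢r r≢p no-pq no-rq no-pr no-rp (1≤ 3≤qp) 1≤qr (inj₁ 3≤qp)
  by-orientation (inj₂ (3≤qp , no-pq)) (inj₁ (1≤qr , no-rq)) (inj₂ (inj₁ (1≤rp , no-pr))) =
    transitive⇒reachesHeavy a q≢r r≢p p≢q no-rq no-pr no-pq 1≤qr 1≤rp (inj₂ (inj₂ 3≤qp))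
  by-orientation (inj₂ (3≤qp , no-pq)) (inj₁ (1≤qr , no-rq)) (inj₂ (inj₂ (1≤pr , no-rp))) =
    transitive⇒reachesHeavy a q≢p p≢r r≢q no-pq no-rp no-rq (1≤ 3≤qp) 1≤pr (inj₁ 3≤qp)
  by-orientation (inj₂ (3≤qp , no-pq)) (inj₂ (1≤rq , no-qr)) (inj₂ (inj₂ (1≤pr , no-rp))) =
    cycle⇒reachesHeavy a (cyclic r≢q q≢p p≢r no-qr no-pq no-rp) 1≤rq (1≤ 3≤qp) 1≤pr (inj₂ (inj₁ 3≤qp))
  by-orientation (inj₂ (3≤qp , no-pq)) (inj₂ (1≤rq , no-qr)) (inj₁ (_ , no-pr)) =
    transitive⇒reachesHeavy a r≢q q≢p p≢r no-qr no-pq no-pr 1≤rq (1≤ 3≤qp) (inj₂ (inj₁ 3≤qp))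
  by-orientation (inj₂ (3≤qp , no-pq)) (inj₂ (1≤rq , no-qr)) (inj₂ (inj₁ (_ , no-pr))) =
    transitive⇒reachesHeavy a r≢q q≢p p≢r no-qr no-pq no-pr 1≤rq (1≤ 3≤qp) (inj₂ (inj₁ 3≤qp))

isolated⇒only : ∀ {n} {a : Arrows n} → Connected a → ∀ v → (∀ j → a v j ≡ 0 × a j v ≡ 0) → ∀ w → v ≡ w
isolated⇒only connected v no-arrows w with connected v w
... | ε = refl
... | inj₁ 0<vj ◅ _ = contradiction (subst (0 <_) (proj₁ (no-arrows _)) 0<vj) λ ()
... | inj₂ 0<jv ◅ _ = contradiction (subst (0 <_) (proj₂ (no-arrows _)) 0<jv) λ ()

hub⇒connected : ∀ {n} {a : Arrows n} h → (∀ i → i ≡ h ⊎ Adjacent a i h) → Connected a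
hub⇒connected {a = a} h spoke i j = to-hub i ◅◅ from-hub j
  where
  to-hub : ∀ i → Star (Adjacent a) i h
  to-hub i with spoke i
  ... | inj₁ refl = ε
  ... | inj₂ i~h = i~h ◅ ε
  from-hub : ∀ j → Star (Adjacent a) h j
  from-hub j with spoke j
  ... | inj₁ refl = ε
  ... | inj₂ j~h = [ inj₂ , inj₁ ]′ j~h ◅ ε

extend : ∀ {n} → Arrows n → (Fin n → ℕ) → (Fin n → ℕ) → Arrows (suc n)
extend a out in′ zero zero = 0
extend a out in′ zero (suc j) = out j
extend a out in′ (suc i) zero = in′ i
extend a out in′ (suc i) (suc j) = a i j

extend-cong : ∀ {n} (a : Arrows n) {out out′ in′ in″ : Fin n → ℕ} →
  (∀ u → out u ≡ out′ u) → (∀ u → in′ u ≡ in″ u) → Induced (λ i → i) (extend a out in′) (extend a out′ in″)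
extend-cong a out≗ in≗ zero zero = refl
extend-cong a out≗ in≗ zero (suc j) = out≗ j
extend-cong a out≗ in≗ (suc i) zero = in≗ i
extend-cong a out≗ in≗ (suc i) (suc j) = refl

cons-injective : ∀ {m n} {f : Fin m → Fin n} {v} → Injective _≡_ _≡_ f → (∀ u → f u ≢ v) →
  Injective _≡_ _≡_ (v Vector.∷ f)
cons-injective f-inj v∉f {zero} {zero} _ = refl
cons-injective f-inj v∉f {zero} {suc j} v≡fj = contradiction (sym v≡fj) (v∉f j)
cons-injective f-inj v∉f {suc i} {zero} fi≡v = contradiction fi≡v (v∉f i)
cons-injective f-inj v∉f {suc i} {suc j} fi≡fj = cong suc (f-inj fi≡fj)

extend-induced : ∀ {m n} {Γ : Arrows n} {s : Arrows m} {f : Fin m → Fin n} {v} →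
  Γ v v ≡ 0 → Induced f Γ s → Induced (v Vector.∷ f) Γ (extend s (λ u → Γ v (f u)) (λ u → Γ (f u) v))
extend-induced no-loop f⇒s zero zero = no-loop
extend-induced no-loop f⇒s zero (suc j) = refl
extend-induced no-loop f⇒s (suc i) zero = refl
extend-induced no-loop f⇒s (suc i) (suc j) = f⇒s i j

-- The ways a vertex can be joined to another by at most two arrows.
data Link : Set where
  none out₁ out₂ in₁ in₂ : Link

outArrows : Link → ℕ
outArrows out₁ = 1
outArrows out₂ = 2
outArrows _ = 0

inArrows : Link → ℕ
inArrows in₁ = 1
inArrows in₂ = 2
inArrows _ = 0

link : ∀ x y → x ≡ 0 ⊎ y ≡ 0 → (3 ≤ x ⊎ 3 ≤ y) ⊎ ∃[ l ] outArrows l ≡ x × inArrows l ≡ y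
link (suc (suc (suc x))) y _ = inj₁ (inj₁ (s≤s (s≤s (s≤s z≤n))))
link x (suc (suc (suc y))) _ = inj₁ (inj₂ (s≤s (s≤s (s≤s z≤n))))
link 0 0 _ = inj₂ (none , refl , refl)
link 1 0 _ = inj₂ (out₁ , refl , refl)
link 2 0 _ = inj₂ (out₂ , refl , refl)
link 0 1 _ = inj₂ (in₁ , refl , refl)
link 0 2 _ = inj₂ (in₂ , refl , refl)
link (suc x) (suc y) (inj₁ ())
link (suc x) (suc y) (inj₂ ())

links : ∀ {n} (out in′ : Fin n → ℕ) → (∀ u → out u ≡ 0 ⊎ in′ u ≡ 0) →
  (∃[ u ] (3 ≤ out u ⊎ 3 ≤ in′ u)) ⊎
  (∃[ ls ] ∀ u → outArrows (lookup ls u) ≡ out u × inArrows (lookup ls u) ≡ in′ u)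
links {zero} out in′ one-way = inj₂ ([] , λ ())
links {suc n} out in′ one-way with link (out zero) (in′ zero) (one-way zero)
... | inj₁ big = inj₁ (zero , big)
... | inj₂ (l , l-correct) with links (out ∘ suc) (in′ ∘ suc) (one-way ∘ suc)
...   | inj₁ (u , big) = inj₁ (suc u , big)
...   | inj₂ (ls , ls-correct) = inj₂ (l ∷ ls , λ { zero → l-correct ; (suc u) → ls-correct u })

induced? : ∀ {m n} (g : Fin m → Fin n) (a : Arrows n) (c : Arrows m) → Dec (Induced g a c)
induced? g a c = all? λ i → all? λ j → a (g i) (g j) ≟ℕ c i j

injective? : ∀ {m n} (g : Fin m → Fin n) → Dec (Injective _≡_ _≡_ g)
injective? g = map′ (λ inj {i} {j} → inj i j) (λ inj i j → inj)
                    (all? λ i → all? λ j → (g i ≟ g j) →-dec (i ≟ j))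

heavy? : ∀ {n} (a : Arrows n) p q r → Dec (Heavy a p q r)
heavy? a p q r =
  map′ (λ (p≢q , q≢r , r≢p , no-qp , no-rq , no-pr , 2≤pq , 2≤qr , 2≤rp , 7≤total) →
          heavy (cyclic p≢q q≢r r≢p no-qp no-rq no-pr) 2≤pq 2≤qr 2≤rp 7≤total)
       (λ (heavy (cyclic p≢q q≢r r≢p no-qp no-rq no-pr) 2≤pq 2≤qr 2≤rp 7≤total) →
          p≢q , q≢r , r≢p , no-qp , no-rq , no-pr , 2≤pq , 2≤qr , 2≤rp , 7≤total)
       (¬? (p ≟ q) ×-dec ¬? (q ≟ r) ×-dec ¬? (r ≟ p) ×-dec
        a q p ≟ℕ 0 ×-dec a r q ≟ℕ 0 ×-dec a p r ≟ℕ 0 ×-dec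
        2 ≤? a p q ×-dec 2 ≤? a q r ×-dec 2 ≤? a r p ×-dec 7 ≤? a p q + a q r + a r p)

adjacent? : ∀ {n} (a : Arrows n) i j → Dec (Adjacent a i j)
adjacent? a i j = 0 <? a i j ⊎-dec 0 <? a j i

isGraph? : ∀ {n} (a : Arrows n) → Dec (IsGraph a)
isGraph? a = (all? λ i → a i i ≟ℕ 0) ×-dec (all? λ i → all? λ j → a i j ≟ℕ 0 ⊎-dec a j i ≟ℕ 0)

isomorphic-by : ∀ {n} (a b : Arrows n) (τ : Vec (Fin n) n) →
  True (injective? (lookup τ)) → True (induced? (lookup τ) a b) → Isomorphic a b
isomorphic-by a b τ injective induced = induced⇒isomorphic {a = a} (toWitness injective) (toWitness induced)

X6+ : Vec Link 6 → Arrows 7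
X6+ ls = extend X6 (outArrows ∘ lookup ls) (inArrows ∘ lookup ls)

-- The new vertex is isolated, resp. attached so as to give X7 (it becomes y₃, X6's w
-- becomes z₃).
no-links x7-links : Vec Link 6
no-links = none ∷ none ∷ none ∷ none ∷ none ∷ none ∷ []
x7-links = in₁ ∷ none ∷ none ∷ none ∷ none ∷ out₂ ∷ []

data Verdict : Vec Link 6 → Set where
  isolated : Verdict no-links
  isX7 : Verdict x7-links
  heavy-after : ∀ {ls} (ks : List (Fin 7)) p q r → True (heavy? (mutations ks (X6+ ls)) p q r) → Verdict ls

verdict : ∀ l₀ l₁ l₂ l₃ l₄ l₅ → Verdict (l₀ ∷ l₁ ∷ l₂ ∷ l₃ ∷ l₄ ∷ l₅ ∷ [])
verdict none none none none none none = isolated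
verdict none none none none none out₁ = heavy-after (1F ∷ 2F ∷ 3F ∷ 6F ∷ 4F ∷ []) 4F 0F 6F tt
verdict none none none none none out₂ = heavy-after (6F ∷ 0F ∷ []) 1F 0F 6F tt
verdict none none none none none in₁ = heavy-after (1F ∷ 2F ∷ 3F ∷ 4F ∷ 6F ∷ 4F ∷ []) 4F 6F 0F tt
verdict none none none none none in₂ = heavy-after (1F ∷ 6F ∷ 0F ∷ []) 1F 6F 0F tt
verdict none none none none out₁ l₅ = heavy-after (4F ∷ 5F ∷ 4F ∷ []) 4F 0F 5F tt
verdict none none none none out₂ l₅ = heavy-after (4F ∷ 5F ∷ []) 4F 5F 0F tt
verdict none none none none in₁ l₅ = heavy-after (5F ∷ 4F ∷ []) 4F 5F 0F tt
verdict none none none none in₂ l₅ = heavy-after (5F ∷ []) 4F 0F 5F tt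
verdict none none none out₁ l₄ none = heavy-after (1F ∷ 2F ∷ 3F ∷ 6F ∷ 4F ∷ 6F ∷ []) 4F 6F 0F tt
verdict none none none out₁ l₄ out₁ = heavy-after (1F ∷ 2F ∷ 3F ∷ 6F ∷ 4F ∷ []) 4F 0F 6F tt
verdict none none none out₁ l₄ out₂ = heavy-after (6F ∷ 0F ∷ []) 1F 0F 6F tt
verdict none none none out₁ l₄ in₁ = heavy-after (1F ∷ 2F ∷ 0F ∷ 4F ∷ 6F ∷ []) 1F 6F 4F tt
verdict none none none out₁ l₄ in₂ = heavy-after (0F ∷ 6F ∷ []) 4F 6F 0F tt
verdict none none none out₂ l₄ l₅ = heavy-after (1F ∷ 4F ∷ 0F ∷ []) 1F 0F 4F tt
verdict none none none in₁ none l₅ = heavy-after (5F ∷ 4F ∷ 5F ∷ []) 4F 0F 5F tt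
verdict none none none in₁ out₁ l₅ = heavy-after (4F ∷ 5F ∷ 4F ∷ []) 4F 0F 5F tt
verdict none none none in₁ out₂ l₅ = heavy-after (4F ∷ 5F ∷ []) 4F 5F 0F tt
verdict none none none in₁ in₁ l₅ = heavy-after (5F ∷ 4F ∷ []) 4F 5F 0F tt
verdict none none none in₁ in₂ l₅ = heavy-after (5F ∷ []) 4F 0F 5F tt
verdict none none none in₂ l₄ l₅ = heavy-after (4F ∷ 0F ∷ []) 1F 4F 0F tt
verdict none none out₁ l₃ l₄ l₅ = heavy-after (2F ∷ 3F ∷ 2F ∷ []) 2F 0F 3F tt
verdict none none out₂ l₃ l₄ l₅ = heavy-after (2F ∷ 3F ∷ []) 2F 3F 0F tt
verdict none none in₁ l₃ l₄ l₅ = heavy-after (3F ∷ 2F ∷ []) 2F 3F 0F tt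
verdict none none in₂ l₃ l₄ l₅ = heavy-after (3F ∷ []) 2F 0F 3F tt
verdict none out₁ none l₃ l₄ l₅ = heavy-after (2F ∷ 3F ∷ []) 2F 3F 0F tt
verdict none out₁ out₁ l₃ l₄ l₅ = heavy-after (2F ∷ 3F ∷ []) 2F 3F 0F tt
verdict none out₁ out₂ l₃ l₄ l₅ = heavy-after (2F ∷ 3F ∷ []) 2F 3F 0F tt
verdict none out₁ in₁ none none none = heavy-after (1F ∷ 4F ∷ 5F ∷ 6F ∷ 2F ∷ 6F ∷ []) 2F 6F 0F tt
verdict none out₁ in₁ none none out₁ = heavy-after (6F ∷ 0F ∷ 1F ∷ 3F ∷ []) 1F 4F 3F tt
verdict none out₁ in₁ none none out₂ = heavy-after (6F ∷ 0F ∷ []) 1F 0F 6F tt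
verdict none out₁ in₁ none none in₁ = heavy-after (1F ∷ 4F ∷ 0F ∷ 2F ∷ 6F ∷ []) 1F 6F 2F tt
verdict none out₁ in₁ none none in₂ = heavy-after (0F ∷ 6F ∷ []) 2F 6F 0F tt
verdict none out₁ in₁ none out₁ l₅ = heavy-after (4F ∷ 5F ∷ 4F ∷ []) 4F 0F 5F tt
verdict none out₁ in₁ none out₂ l₅ = heavy-after (4F ∷ 5F ∷ []) 4F 5F 0F tt
verdict none out₁ in₁ none in₁ l₅ = heavy-after (5F ∷ 4F ∷ []) 4F 5F 0F tt
verdict none out₁ in₁ none in₂ l₅ = heavy-after (5F ∷ []) 4F 0F 5F tt
verdict none out₁ in₁ out₁ l₄ none = heavy-after (1F ∷ 6F ∷ 0F ∷ 3F ∷ 4F ∷ []) 1F 3F 4F tt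
verdict none out₁ in₁ out₁ l₄ out₁ = heavy-after (1F ∷ 6F ∷ 2F ∷ 0F ∷ []) 2F 4F 0F tt
verdict none out₁ in₁ out₁ l₄ out₂ = heavy-after (6F ∷ 0F ∷ []) 1F 0F 6F tt
verdict none out₁ in₁ out₁ l₄ in₁ = heavy-after (1F ∷ 0F ∷ 2F ∷ 6F ∷ []) 2F 4F 6F tt
verdict none out₁ in₁ out₁ l₄ in₂ = heavy-after (0F ∷ 6F ∷ []) 2F 6F 0F tt
verdict none out₁ in₁ out₂ l₄ l₅ = heavy-after (0F ∷ 4F ∷ []) 3F 0F 4F tt
verdict none out₁ in₁ in₁ none l₅ = heavy-after (5F ∷ 4F ∷ 5F ∷ []) 4F 0F 5F tt
verdict none out₁ in₁ in₁ out₁ l₅ = heavy-after (4F ∷ 5F ∷ 4F ∷ []) 4F 0F 5F tt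
verdict none out₁ in₁ in₁ out₂ l₅ = heavy-after (4F ∷ 5F ∷ []) 4F 5F 0F tt
verdict none out₁ in₁ in₁ in₁ l₅ = heavy-after (5F ∷ 4F ∷ []) 4F 5F 0F tt
verdict none out₁ in₁ in₁ in₂ l₅ = heavy-after (5F ∷ []) 4F 0F 5F tt
verdict none out₁ in₁ in₂ l₄ l₅ = heavy-after (4F ∷ 0F ∷ []) 1F 4F 0F tt
verdict none out₁ in₂ l₃ l₄ l₅ = heavy-after (3F ∷ []) 2F 0F 3F tt
verdict none out₂ l₂ l₃ l₄ l₅ = heavy-after (1F ∷ 2F ∷ 0F ∷ []) 1F 0F 2F tt
verdict none in₁ none l₃ l₄ l₅ = heavy-after (3F ∷ 2F ∷ 3F ∷ []) 2F 0F 3F tt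
verdict none in₁ out₁ l₃ l₄ l₅ = heavy-after (2F ∷ 3F ∷ 2F ∷ []) 2F 0F 3F tt
verdict none in₁ out₂ l₃ l₄ l₅ = heavy-after (2F ∷ 3F ∷ []) 2F 3F 0F tt
verdict none in₁ in₁ l₃ l₄ l₅ = heavy-after (3F ∷ 2F ∷ []) 2F 3F 0F tt
verdict none in₁ in₂ l₃ l₄ l₅ = heavy-after (3F ∷ []) 2F 0F 3F tt
verdict none in₂ l₂ l₃ l₄ l₅ = heavy-after (2F ∷ 0F ∷ []) 1F 2F 0F tt
verdict out₁ none none l₃ none none = heavy-after (1F ∷ 5F ∷ 6F ∷ 0F ∷ 2F ∷ 1F ∷ []) 1F 2F 3F tt
verdict out₁ none none l₃ none out₁ = heavy-after (6F ∷ 1F ∷ 0F ∷ []) 1F 2F 0F tt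
verdict out₁ none none l₃ none out₂ = heavy-after (6F ∷ 0F ∷ []) 1F 0F 6F tt
verdict out₁ none none l₃ none in₁ = heavy-after (0F ∷ 1F ∷ 6F ∷ []) 1F 2F 6F tt
verdict out₁ none none l₃ none in₂ = heavy-after (0F ∷ 6F ∷ []) 1F 6F 0F tt
verdict out₁ none none l₃ out₁ l₅ = heavy-after (5F ∷ 1F ∷ 0F ∷ []) 1F 2F 0F tt
verdict out₁ none none l₃ out₂ l₅ = heavy-after (5F ∷ 0F ∷ []) 1F 0F 5F tt
verdict out₁ none none l₃ in₁ l₅ = heavy-after (0F ∷ 1F ∷ 5F ∷ []) 1F 2F 5F tt
verdict out₁ none none l₃ in₂ l₅ = heavy-after (0F ∷ 5F ∷ []) 1F 5F 0F tt
verdict out₁ out₁ none l₃ l₄ l₅ = heavy-after (2F ∷ 3F ∷ []) 2F 3F 0F tt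
verdict out₁ out₂ none l₃ l₄ l₅ = heavy-after (2F ∷ []) 2F 0F 3F tt
verdict out₁ in₁ none l₃ l₄ l₅ = heavy-after (3F ∷ 2F ∷ 3F ∷ []) 2F 0F 3F tt
verdict out₁ in₂ none l₃ l₄ l₅ = heavy-after (3F ∷ 2F ∷ []) 2F 3F 0F tt
verdict out₁ none out₁ l₃ l₄ l₅ = heavy-after (2F ∷ 3F ∷ 2F ∷ []) 2F 0F 3F tt
verdict out₁ out₁ out₁ l₃ l₄ l₅ = heavy-after (2F ∷ 3F ∷ []) 2F 3F 0F tt
verdict out₁ out₂ out₁ l₃ l₄ l₅ = heavy-after (2F ∷ []) 2F 0F 3F tt
verdict out₁ in₁ out₁ l₃ l₄ l₅ = heavy-after (2F ∷ 3F ∷ 2F ∷ []) 2F 0F 3F tt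
verdict out₁ in₂ out₁ l₃ l₄ l₅ = heavy-after (3F ∷ 2F ∷ []) 2F 3F 0F tt
verdict out₁ l₁ out₂ l₃ l₄ l₅ = heavy-after (3F ∷ 0F ∷ []) 1F 0F 3F tt
verdict out₁ l₁ in₁ l₃ none l₅ = heavy-after (5F ∷ 0F ∷ 1F ∷ 3F ∷ []) 1F 5F 3F tt
verdict out₁ l₁ in₁ l₃ out₁ l₅ = heavy-after (5F ∷ 0F ∷ 1F ∷ []) 1F 3F 0F tt
verdict out₁ l₁ in₁ l₃ out₂ l₅ = heavy-after (5F ∷ 0F ∷ []) 1F 0F 5F tt
verdict out₁ l₁ in₁ l₃ in₁ l₅ = heavy-after (0F ∷ 3F ∷ 1F ∷ []) 1F 5F 3F tt
verdict out₁ l₁ in₁ l₃ in₂ l₅ = heavy-after (0F ∷ 5F ∷ []) 1F 5F 0F tt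
verdict out₁ l₁ in₂ l₃ l₄ l₅ = heavy-after (0F ∷ 3F ∷ []) 1F 3F 0F tt
verdict out₂ l₁ none l₃ l₄ l₅ = heavy-after (3F ∷ 1F ∷ 0F ∷ []) 1F 3F 0F tt
verdict out₂ l₁ out₁ l₃ l₄ l₅ = heavy-after (1F ∷ 0F ∷ 1F ∷ []) 1F 0F 3F tt
verdict out₂ l₁ out₂ l₃ l₄ l₅ = heavy-after (1F ∷ 0F ∷ []) 1F 3F 0F tt
verdict out₂ l₁ in₁ l₃ l₄ l₅ = heavy-after (0F ∷ 1F ∷ []) 1F 3F 0F tt
verdict out₂ l₁ in₂ l₃ l₄ l₅ = heavy-after (0F ∷ []) 1F 0F 3F tt
verdict in₁ none none none none none = heavy-after (1F ∷ 2F ∷ 3F ∷ 4F ∷ 6F ∷ []) 4F 0F 6F tt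
verdict in₁ none none none none out₁ = heavy-after (1F ∷ 2F ∷ 3F ∷ 4F ∷ 6F ∷ 4F ∷ []) 4F 6F 0F tt
verdict in₁ none none none none out₂ = isX7
verdict in₁ none none none none in₁ = heavy-after (1F ∷ 2F ∷ 6F ∷ 0F ∷ []) 2F 6F 0F tt
verdict in₁ none none none none in₂ = heavy-after (1F ∷ 6F ∷ 0F ∷ []) 1F 6F 0F tt
verdict in₁ none none none out₁ l₅ = heavy-after (4F ∷ 5F ∷ 4F ∷ []) 4F 0F 5F tt
verdict in₁ none none none out₂ l₅ = heavy-after (4F ∷ 5F ∷ []) 4F 5F 0F tt
verdict in₁ none none none in₁ l₅ = heavy-after (5F ∷ 4F ∷ []) 4F 5F 0F tt
verdict in₁ none none none in₂ l₅ = heavy-after (5F ∷ []) 4F 0F 5F tt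
verdict in₁ none none out₁ l₄ l₅ = heavy-after (0F ∷ 1F ∷ 4F ∷ []) 1F 4F 3F tt
verdict in₁ none none out₂ l₄ l₅ = heavy-after (0F ∷ 4F ∷ []) 1F 0F 4F tt
verdict in₁ none none in₁ l₄ l₅ = heavy-after (4F ∷ 1F ∷ 0F ∷ []) 1F 0F 3F tt
verdict in₁ none none in₂ l₄ l₅ = heavy-after (4F ∷ 0F ∷ []) 1F 4F 0F tt
verdict in₁ none out₁ l₃ l₄ l₅ = heavy-after (2F ∷ 3F ∷ 2F ∷ []) 2F 0F 3F tt
verdict in₁ none out₂ l₃ l₄ l₅ = heavy-after (2F ∷ 3F ∷ []) 2F 3F 0F tt
verdict in₁ none in₁ l₃ l₄ l₅ = heavy-after (3F ∷ 2F ∷ []) 2F 3F 0F tt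
verdict in₁ none in₂ l₃ l₄ l₅ = heavy-after (3F ∷ []) 2F 0F 3F tt
verdict in₁ out₁ l₂ none l₄ l₅ = heavy-after (4F ∷ 0F ∷ 1F ∷ 2F ∷ []) 1F 2F 4F tt
verdict in₁ out₁ l₂ out₁ l₄ l₅ = heavy-after (0F ∷ 2F ∷ 1F ∷ []) 1F 2F 4F tt
verdict in₁ out₁ l₂ out₂ l₄ l₅ = heavy-after (0F ∷ 4F ∷ []) 1F 0F 4F tt
verdict in₁ out₁ l₂ in₁ l₄ l₅ = heavy-after (4F ∷ 0F ∷ 1F ∷ []) 1F 0F 2F tt
verdict in₁ out₁ l₂ in₂ l₄ l₅ = heavy-after (4F ∷ 0F ∷ []) 1F 4F 0F tt
verdict in₁ out₂ l₂ l₃ l₄ l₅ = heavy-after (0F ∷ 2F ∷ []) 1F 0F 2F tt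
verdict in₁ in₁ none l₃ l₄ l₅ = heavy-after (3F ∷ 2F ∷ 3F ∷ []) 2F 0F 3F tt
verdict in₁ in₁ out₁ l₃ l₄ l₅ = heavy-after (2F ∷ 3F ∷ 2F ∷ []) 2F 0F 3F tt
verdict in₁ in₁ out₂ l₃ l₄ l₅ = heavy-after (2F ∷ 3F ∷ []) 2F 3F 0F tt
verdict in₁ in₁ in₁ l₃ l₄ l₅ = heavy-after (3F ∷ 2F ∷ []) 2F 3F 0F tt
verdict in₁ in₁ in₂ l₃ l₄ l₅ = heavy-after (3F ∷ []) 2F 0F 3F tt
verdict in₁ in₂ l₂ l₃ l₄ l₅ = heavy-after (2F ∷ 0F ∷ []) 1F 2F 0F tt
verdict in₂ none l₂ l₃ l₄ l₅ = heavy-after (2F ∷ 1F ∷ 0F ∷ []) 1F 0F 2F tt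
verdict in₂ out₁ l₂ l₃ l₄ l₅ = heavy-after (0F ∷ 1F ∷ []) 1F 0F 2F tt
verdict in₂ out₂ l₂ l₃ l₄ l₅ = heavy-after (0F ∷ []) 1F 2F 0F tt
verdict in₂ in₁ l₂ l₃ l₄ l₅ = heavy-after (1F ∷ 0F ∷ 1F ∷ []) 1F 2F 0F tt
verdict in₂ in₂ l₂ l₃ l₄ l₅ = heavy-after (1F ∷ 0F ∷ []) 1F 0F 2F tt

x7-contains-X6 : ContainsSubgraph X7 X6
x7-contains-X6 = lookup embedding , toWitness {a? = injective? (lookup embedding)} tt ,
                 toWitness {a? = induced? (lookup embedding) X7 X6} tt
  where
  embedding : Vec (Fin 7) 6
  embedding = 0F ∷ 1F ∷ 2F ∷ 3F ∷ 4F ∷ 6F ∷ []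

x7-graph : IsGraph X7
x7-graph = toWitness {a? = isGraph? X7} tt

x7-connected : Connected X7
x7-connected = hub⇒connected 0F (toWitness {a? = all? λ i → i ≟ 0F ⊎-dec adjacent? X7 i 0F} tt)

-- Up to isomorphism the mutation class of X7 is {X7, μₓX7}, where μₓX7 is X7
-- mutated at x.
μₓX7 : Arrows 7
μₓX7 = mutate 0F X7

x7-class : List (Arrows 7)
x7-class = X7 ∷ μₓX7 ∷ []

mutation-in-class : ∀ b k (τ : Vec (Fin 7) 7) {c} → c ∈ x7-class →
  True (injective? (lookup τ)) → True (induced? (lookup τ) (mutate k b) c) →
  Any (Isomorphic (mutate k b)) x7-class
mutation-in-class b k τ c∈class injective induced =
  Any.map (λ { refl → isomorphic-by (mutate k b) _ τ injective induced }) c∈class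

-- Mutating X7 at y_i or z_i gives X7 with y_i and z_i swapped.
mutations-of-X7 : ∀ k → Any (Isomorphic (mutate k X7)) x7-class
mutations-of-X7 0F = mutation-in-class X7 0F (0F ∷ 1F ∷ 2F ∷ 3F ∷ 4F ∷ 5F ∷ 6F ∷ []) (there (here refl)) tt tt
mutations-of-X7 1F = mutation-in-class X7 1F (0F ∷ 2F ∷ 1F ∷ 3F ∷ 4F ∷ 5F ∷ 6F ∷ []) (here refl) tt tt
mutations-of-X7 2F = mutation-in-class X7 2F (0F ∷ 2F ∷ 1F ∷ 3F ∷ 4F ∷ 5F ∷ 6F ∷ []) (here refl) tt tt
mutations-of-X7 3F = mutation-in-class X7 3F (0F ∷ 1F ∷ 2F ∷ 4F ∷ 3F ∷ 5F ∷ 6F ∷ []) (here refl) tt tt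
mutations-of-X7 4F = mutation-in-class X7 4F (0F ∷ 1F ∷ 2F ∷ 4F ∷ 3F ∷ 5F ∷ 6F ∷ []) (here refl) tt tt
mutations-of-X7 5F = mutation-in-class X7 5F (0F ∷ 1F ∷ 2F ∷ 3F ∷ 4F ∷ 6F ∷ 5F ∷ []) (here refl) tt tt
mutations-of-X7 6F = mutation-in-class X7 6F (0F ∷ 1F ∷ 2F ∷ 3F ∷ 4F ∷ 6F ∷ 5F ∷ []) (here refl) tt tt

-- Mutating μₓX7 at x gives back X7; at any other vertex, a relabelled μₓX7.
mutations-of-μₓX7 : ∀ k → Any (Isomorphic (mutate k μₓX7)) x7-class
mutations-of-μₓX7 0F = mutation-in-class μₓX7 0F (0F ∷ 1F ∷ 2F ∷ 3F ∷ 4F ∷ 5F ∷ 6F ∷ []) (here refl) tt tt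
mutations-of-μₓX7 1F = mutation-in-class μₓX7 1F (2F ∷ 0F ∷ 1F ∷ 4F ∷ 5F ∷ 6F ∷ 3F ∷ []) (there (here refl)) tt tt
mutations-of-μₓX7 2F = mutation-in-class μₓX7 2F (1F ∷ 2F ∷ 0F ∷ 4F ∷ 5F ∷ 6F ∷ 3F ∷ []) (there (here refl)) tt tt
mutations-of-μₓX7 3F = mutation-in-class μₓX7 3F (4F ∷ 0F ∷ 3F ∷ 2F ∷ 5F ∷ 6F ∷ 1F ∷ []) (there (here refl)) tt tt
mutations-of-μₓX7 4F = mutation-in-class μₓX7 4F (3F ∷ 2F ∷ 5F ∷ 4F ∷ 0F ∷ 6F ∷ 1F ∷ []) (there (here refl)) tt tt
mutations-of-μₓX7 5F = mutation-in-class μₓX7 5F (6F ∷ 0F ∷ 5F ∷ 2F ∷ 3F ∷ 4F ∷ 1F ∷ []) (there (here refl)) tt tt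
mutations-of-μₓX7 6F = mutation-in-class μₓX7 6F (5F ∷ 2F ∷ 3F ∷ 4F ∷ 1F ∷ 6F ∷ 0F ∷ []) (there (here refl)) tt tt

x7-class-closed : MutationClosed x7-class
x7-class-closed (here refl) = mutations-of-X7
x7-class-closed (there (here refl)) = mutations-of-μₓX7

x7-mutationFinite : MutationFinite X7
x7-mutationFinite = closed⇒mutationFinite x7-class-closed (here (Perm.id , λ _ _ → refl))

x6-neighbour : Fin 6 → Fin 6
x6-neighbour 0F = 1F
x6-neighbour (suc _) = 0F

x6-neighbour-adjacent : ∀ u → u ≢ x6-neighbour u × Adjacent X6 u (x6-neighbour u)
x6-neighbour-adjacent =
  toWitness {a? = all? λ u → ¬? (u ≟ x6-neighbour u) ×-dec adjacent? X6 u (x6-neighbour u)} tt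

module Uniqueness (Γ : Arrows 7) (graph : IsGraph Γ) (connected : Connected Γ) (finite : MutationFinite Γ)
                  (f : Fin 6 → Fin 7) (f-injective : Injective _≡_ _≡_ f) (f⇒X6 : Induced f Γ X6)
                  (v : Fin 7) (v∉f : ∀ u → f u ≢ v) where

  g : Fin 7 → Fin 7
  g = v Vector.∷ f

  g-injective : Injective _≡_ _≡_ g
  g-injective = cons-injective f-injective v∉f

  out in′ : Fin 6 → ℕ
  out u = Γ v (f u)
  in′ u = Γ (f u) v

  g⇒extension : Induced g Γ (extend X6 out in′)
  g⇒extension = extend-induced {Γ = Γ} {f = f} (proj₁ graph v) f⇒X6

  ¬heavy : ∀ {c} → Induced g Γ c → ¬ ReachesHeavy c
  ¬heavy g⇒c = mutationFinite⇒¬reachesHeavy finite ∘ reachesHeavy-induced g-injective {Γ} g⇒c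

  -- v is not joined to any vertex of X6 by three or more arrows: together with a
  -- neighbour of that vertex in X6 they would form a triangle reaching a heavy one.
  ¬big-link : ∀ u → ¬ (3 ≤ out u ⊎ 3 ≤ in′ u)
  ¬big-link u big with x6-neighbour-adjacent u
  ... | u≢w , u~w = mutationFinite⇒¬reachesHeavy finite
        (heavy-edge⇒reachesHeavy graph (v∉f u ∘ sym) (u≢w ∘ f-injective) (v∉f (x6-neighbour u)) big
          (subst₂ (λ x y → 0 < x ⊎ 0 < y) (sym (f⇒X6 u _)) (sym (f⇒X6 _ u)) u~w))

  ¬isolated : ¬ Induced g Γ (X6+ no-links)
  ¬isolated g⇒c = v∉f 0F (sym (isolated⇒only connected v no-arrows (f 0F)))
    where
    no-arrows-in-c : ∀ i → X6+ no-links 0F i ≡ 0 × X6+ no-links i 0F ≡ 0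
    no-arrows-in-c =
      toWitness {a? = all? λ i → X6+ no-links 0F i ≟ℕ 0 ×-dec X6+ no-links i 0F ≟ℕ 0} tt
    no-arrows : ∀ j → Γ v j ≡ 0 × Γ j v ≡ 0
    no-arrows j with injective⇒surjective g-injective j
    ... | i , refl =
      trans (g⇒c 0F i) (proj₁ (no-arrows-in-c i)) , trans (g⇒c i 0F) (proj₂ (no-arrows-in-c i))

  by-verdict : ∀ ls → Induced g Γ (X6+ ls) → Isomorphic Γ X7
  by-verdict (l₀ ∷ l₁ ∷ l₂ ∷ l₃ ∷ l₄ ∷ l₅ ∷ []) g⇒c with verdict l₀ l₁ l₂ l₃ l₄ l₅
  ... | isolated = contradiction g⇒c ¬isolated
  ... | isX7 = isomorphic-trans {a = Γ} (induced⇒isomorphic {a = Γ} g-injective g⇒c)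
                 (isomorphic-by (X6+ x7-links) X7 (1F ∷ 2F ∷ 3F ∷ 4F ∷ 5F ∷ 0F ∷ 6F ∷ []) tt tt)
  ... | heavy-after ks p q r certificate =
    contradiction (_ , reachable-mutations ks _ , p , q , r , toWitness certificate) (¬heavy g⇒c)

  isomorphic-to-X7 : Isomorphic Γ X7
  isomorphic-to-X7 with links out in′ (λ u → proj₂ graph v (f u))
  ... | inj₁ (u , big) = contradiction big (¬big-link u)
  ... | inj₂ (ls , ls-correct) =
    by-verdict ls (induced-∘ {h = λ i → i} {a = Γ} g⇒extension
      (extend-cong X6 (λ u → sym (proj₁ (ls-correct u))) (λ u → sym (proj₂ (ls-correct u)))))

theorem9 : (IsGraph X7 × Connected X7 × MutationFinite X7 × ContainsSubgraph X7 X6)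
    × ((Γ : Arrows 7) → IsGraph Γ → Connected Γ → MutationFinite Γ → ContainsSubgraph Γ X6 → Isomorphic Γ X7)
theorem9 = (x7-graph , x7-connected , x7-mutationFinite , x7-contains-X6) ,
  λ Γ graph connected finite (f , f-injective , f⇒X6) →
    let v , v∉f = injective⇒missing f-injective
    in Uniqueness.isomorphic-to-X7 Γ graph connected finite f f-injective f⇒X6 v v∉f
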